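{- Let $G_s$ be a strongly connected digraph with start vertex $s$, let $r$ be either a marked vertex of $G_s$ or $s$, and let $H_r=H(G_s,r)$. Let $u,v$ be vertices of $H_r$, and let $(x,y)$ be an edge of $G_s$ such that either (1) $x$ and $y$ are both ordinary vertices of $H_r$, or (2) $y$ is a marked vertex of $G_s$ with $x=d(y)\in T(r)$, or (3) $r\neq s$ and $(x,y)=(d(r),r)$. Then $u$ can reach $v$ in $G_s\setminus(x,y)$ if and only if $u$ can reach $v$ in $H_r\setminus(x,y)$.
   Context: Digraphs may have multiple edges. For a strongly connected digraph $G_s$ with start vertex $s$: $u$ dominates $v$ if every path from $s$ to $v$ contains $u$; the dominator tree $D(G_s)$ is rooted at $s$ with $u$ an ancestor of $v$ iff $u$ dominates $v$; $d(v)$ is the parent of $v\ne s$, $D(r)$ the set of descendants of $r$. An edge $(u,v)$ is a bridge of $G_s$ if every path from $s$ to $v$ uses it; then $v$ is marked. Deleting from $D(G_s)$ the edges $(d(v),v)$ for all marked $v$ splits it into subtrees; $T(r)$ is the subtree rooted at $r$. The auxiliary graph $H(G_s,r)$ is obtained from $G_s$ by contracting, for every marked $z$ with $d(z)\in T(r)$, the set $D(z)$ into the vertex $z$, and, if $r\neq s$, contracting $V(G_s)\setminus D(r)$ into the vertex $d(r)$; resulting self-loops are removed and every edge of multiplicity at least two is kept with multiplicity two. Vertices of $T(r)$ are ordinary in $H(G_s,r)$. In each of cases (1)–(3) the edge $(x,y)$ is also an edge of $H_r$. -}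

module Defs where

open import Data.Nat using (ℕ; zero; suc; _⊓_; _∸_; _<_)
open import Data.Fin using (Fin; _≟_)
open import Data.List using (List; length; filter; allFin)
open import Data.Product using (Σ; ∃; ∃-syntax; _×_; _,_)
open import Data.Sum using (_⊎_)
open import Relation.Nullary using (¬_; Dec; yes; no; does)
open import Relation.Nullary.Decidable using (_×-dec_)
open import Relation.Binary.PropositionalEquality using (_≡_)
open import Data.Bool using (if_then_else_)

record Digraph : Set where
  field
    n   : ℕ
    m   : ℕ
    src : Fin m → Fin n
    tgt : Fin m → Fin n

module _ (G : Digraph) where
  open Digraph G

  Vertex : Set
  Vertex = Fin n

  data Walk : Vertex → Vertex → Set where
    here : ∀ {a} → Walk a a
    step : ∀ {a b} (e : Fin m) → src e ≡ a → Walk (tgt e) b → Walk a b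

  Visits : ∀ {a b} → Vertex → Walk a b → Set
  Visits u (here {a}) = u ≡ a
  Visits u (step {a} e _ w) = u ≡ a ⊎ Visits u w

  Uses : ∀ {a b} → Fin m → Walk a b → Set
  Uses f here = Data.Empty.⊥ where import Data.Empty
  Uses f (step e _ w) = f ≡ e ⊎ Uses f w

  data ReachWithout (e : Fin m) : Vertex → Vertex → Set where
    here : ∀ {a} → ReachWithout e a a
    step : ∀ {a b} (f : Fin m) → ¬ f ≡ e → src f ≡ a →
           ReachWithout e (tgt f) b → ReachWithout e a b

  StronglyConnected : Set
  StronglyConnected = ∀ u v → Walk u v

  module _ (s : Vertex) where
    Dom : Vertex → Vertex → Set
    Dom u v = (w : Walk s v) → Visits u w

    -- a = d(v), the parent of v in the dominator tree (immediate dominator)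
    IDom : Vertex → Vertex → Set
    IDom a v = ¬ a ≡ v × Dom a v × (∀ w → ¬ w ≡ v → Dom w v → Dom w a)

    Bridge : Fin m → Set
    Bridge e = (w : Walk s (tgt e)) → Uses e w

    Marked : Vertex → Set
    Marked v = ∃[ e ] (tgt e ≡ v × Bridge e)

    InD : Vertex → Vertex → Set
    InD r v = Dom r v

    -- v ∈ T(r): v is a descendant of r in D(G_s) and the tree path from
    -- r to v contains no marked vertex other than r
    InT : Vertex → Vertex → Set
    InT r v = Dom r v × (∀ w → Dom r w → Dom w v → Marked w → w ≡ r)

    -- π is the contraction map G_s → H(G_s , r): it sends each vertex of
    -- G_s to the vertex of H(G_s , r) into which it is contracted.
    IsContraction : Vertex → (Vertex → Vertex) → Set
    IsContraction r π =
      (∀ w → InT r w → π w ≡ w) ×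
      (∀ z p w → Marked z → IDom p z → InT r p → InD z w → π w ≡ z) ×
      (¬ r ≡ s → ∀ p w → IDom p r → ¬ InD r w → π w ≡ p)

  countImage : (Vertex → Vertex) → Vertex → Vertex → ℕ
  countImage π a b =
    length (filter (λ e → (π (src e) ≟ a) ×-dec (π (tgt e) ≟ b)) (allFin m))

  multH : (Vertex → Vertex) → Vertex → Vertex → ℕ
  multH π a b with a ≟ b
  ... | yes _ = 0
  ... | no _  = 2 ⊓ countImage π a b

  multHWithout : (Vertex → Vertex) → Vertex → Vertex → Vertex → Vertex → ℕ
  multHWithout π x y a b =
    if does ((a ≟ x) ×-dec (b ≟ y)) then multH π a b ∸ 1 else multH π a b

  data ReachM (μ : Vertex → Vertex → ℕ) : Vertex → Vertex → Set where
    here : ∀ {a} → ReachM μ a a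
    step : ∀ {a c b} → 0 < μ a c → ReachM μ c b → ReachM μ a b

  VertexH : (Vertex → Vertex) → Vertex → Set
  VertexH π u = ∃[ w ] (π w ≡ u)

-- The contraction π sends a walk of G_s ∖ (x,y) to a walk of H_r ∖ (x,y): an edge
-- whose endpoints are identified becomes a dropped self-loop, and any other edge
-- f ≠ (x,y) keeps a copy of its image, because an image shared with (x,y) has
-- multiplicity two. Conversely an edge (a,c) of H_r ∖ (x,y) is the image of some
-- edge f ≠ (x,y) of G_s, and it suffices to reach the tail of f from a and c from
-- the head of f in G_s ∖ (x,y). Inside a contracted D(z) every vertex is reachable
-- from z without (x,y), since x ∉ D(z); an edge entering D(z) from outside ends at
-- z; an edge leaving V ∖ D(r) is the bridge (d(r), r); and from the head of an edge
-- into V ∖ D(r) one reaches d(r) without entering D(r), which (x,y) touches.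
-- Dominance and bridges are decidable by a finite search, so all case splits on
-- them are constructive.

module Submission where

open import Defs
open import Data.Fin using (Fin)
open import Data.Product using (_×_)
open import Data.Sum using (_⊎_)
open import Relation.Nullary using (¬_)
open import Relation.Binary.PropositionalEquality using (_≡_)

open import Data.Bool using (true; false; if_then_else_)
open import Data.Empty using (⊥; ⊥-elim)
open import Data.Fin using (_≟_)
open import Data.Fin.Properties using (any?)
open import Data.List using (List; []; _∷_; length; filter; allFin)
open import Data.List.Membership.Propositional using (_∈_)
open import Data.List.Membership.Propositional.Properties
  using (∈-filter⁺; ∈-filter⁻; ∈-allFin; ∈-length)
open import Data.List.Properties using (filter-notAll)
open import Data.List.Relation.Binary.Subset.Propositional using (_⊆_)
open import Data.List.Relation.Unary.All using (_∷_)
open import Data.List.Relation.Unary.AllPairs using (_∷_)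
open import Data.List.Relation.Unary.Any using (here; there)
import Data.List.Relation.Unary.Any as Any
open import Data.List.Relation.Unary.Unique.Propositional using (Unique)
open import Data.List.Relation.Unary.Unique.Propositional.Properties using (allFin⁺; filter⁺)
open import Data.Nat using (zero; suc; _≤_; _<_; z≤n; s≤s; _⊓_; _∸_)
open import Data.Nat.Properties
  using (≤-refl; ≤-pred; <-≤-trans; ⊓-glb; m≤n⊓o⇒m≤o; m<n⇒0<n∸m; m∸n≢0⇒n<m; n≮n; <⇒≢)
open import Data.Product using (Σ; ∃; _,_; proj₁; proj₂)
open import Data.Sum using (inj₁; inj₂; [_,_]; map₁)
open import Data.Unit using (⊤; tt)
open import Function using (_∘_)
open import Relation.Nullary using (Dec; yes; no; does)
open import Relation.Nullary.Decidable
  using (_×-dec_; _⊎-dec_; ¬?; map′; decidable-stable; dec-true; dec-false)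
open import Relation.Unary using (Decidable)
open import Relation.Binary.PropositionalEquality
  using (_≢_; ≢-sym; refl; sym; trans; cong; subst; subst₂)

¬∃¬⇒∀ : ∀ {A : Set} {Q : A → Set} → (∀ a → Dec (Q a)) →
        ¬ ∃ (λ a → ¬ Q a) → ∀ a → Q a
¬∃¬⇒∀ Q? ¬counterexample a = decidable-stable (Q? a) (λ ¬q → ¬counterexample (a , ¬q))

_∖_ : ∀ {n} → List (Fin n) → Fin n → List (Fin n)
A ∖ a = filter (λ v → ¬? (v ≟ a)) A

∈-∖⁺ : ∀ {n} {A : List (Fin n)} {a v} → v ∈ A → v ≢ a → v ∈ A ∖ a
∈-∖⁺ = ∈-filter⁺ (λ v → ¬? (v ≟ _))

∈-∖⁻ : ∀ {n} {A : List (Fin n)} {a v} → v ∈ A ∖ a → v ∈ A × v ≢ a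
∈-∖⁻ {A = A} = ∈-filter⁻ (λ v → ¬? (v ≟ _)) {xs = A}

∖-shrinks : ∀ {n} {A : List (Fin n)} {a} → a ∈ A → length (A ∖ a) < length A
∖-shrinks {A = A} a∈A =
  filter-notAll (λ v → ¬? (v ≟ _)) A (Any.map (λ a≡v v≢a → v≢a (sym a≡v)) a∈A)

module Walks (G : Digraph) where
  open Digraph G

  infixr 5 _++_
  _++_ : ∀ {a b c} → Walk G a b → Walk G b c → Walk G a c
  here        ++ q = q
  step e eq p ++ q = step e eq (p ++ q)

  VisitsBeforeEnd : ∀ {a b} → Fin n → Walk G a b → Set
  VisitsBeforeEnd u here             = ⊥
  VisitsBeforeEnd u (step {a} _ _ w) = u ≡ a ⊎ VisitsBeforeEnd u w

  VisitsAfterStart : ∀ {a b} → Fin n → Walk G a b → Set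
  VisitsAfterStart u here         = ⊥
  VisitsAfterStart u (step _ _ w) = Visits G u w

  visits-start : ∀ {a b} (w : Walk G a b) → Visits G a w
  visits-start here         = refl
  visits-start (step _ _ _) = inj₁ refl

  visits-end : ∀ {a b} (w : Walk G a b) → Visits G b w
  visits-end here         = refl
  visits-end (step _ _ w) = inj₂ (visits-end w)

  visits-++⁻ : ∀ {a b c v} (p : Walk G a b) (q : Walk G b c) →
               Visits G v (p ++ q) → Visits G v p ⊎ Visits G v q
  visits-++⁻ here         q h        = inj₂ h
  visits-++⁻ (step _ _ p) q (inj₁ h) = inj₁ (inj₁ h)
  visits-++⁻ (step _ _ p) q (inj₂ h) = map₁ inj₂ (visits-++⁻ p q h)

  visits-++⁺ˡ : ∀ {a b c v} (p : Walk G a b) (q : Walk G b c) → Visits G v p → Visits G v (p ++ q)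
  visits-++⁺ˡ here         q refl     = visits-start q
  visits-++⁺ˡ (step _ _ p) q (inj₁ h) = inj₁ h
  visits-++⁺ˡ (step _ _ p) q (inj₂ h) = inj₂ (visits-++⁺ˡ p q h)

  visits-++⁺ʳ : ∀ {a b c v} (p : Walk G a b) (q : Walk G b c) → Visits G v q → Visits G v (p ++ q)
  visits-++⁺ʳ here         q h = h
  visits-++⁺ʳ (step _ _ p) q h = inj₂ (visits-++⁺ʳ p q h)

  visitsBeforeEnd-++⁺ˡ : ∀ {a b c v} (p : Walk G a b) (q : Walk G b c) →
                         VisitsBeforeEnd v p → VisitsBeforeEnd v (p ++ q)
  visitsBeforeEnd-++⁺ˡ (step _ _ p) q (inj₁ h) = inj₁ h
  visitsBeforeEnd-++⁺ˡ (step _ _ p) q (inj₂ h) = inj₂ (visitsBeforeEnd-++⁺ˡ p q h)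

  visitsBeforeEnd⇒visits : ∀ {a b v} (w : Walk G a b) → VisitsBeforeEnd v w → Visits G v w
  visitsBeforeEnd⇒visits (step _ _ w) (inj₁ h) = inj₁ h
  visitsBeforeEnd⇒visits (step _ _ w) (inj₂ h) = inj₂ (visitsBeforeEnd⇒visits w h)

  visits⇒visitsBeforeEnd⊎end : ∀ {a b v} (w : Walk G a b) → Visits G v w →
                               VisitsBeforeEnd v w ⊎ v ≡ b
  visits⇒visitsBeforeEnd⊎end here         h        = inj₂ h
  visits⇒visitsBeforeEnd⊎end (step _ _ w) (inj₁ h) = inj₁ (inj₁ h)
  visits⇒visitsBeforeEnd⊎end (step _ _ w) (inj₂ h) = map₁ inj₂ (visits⇒visitsBeforeEnd⊎end w h)

  visitsAfterStart⇒visits : ∀ {a b v} (w : Walk G a b) → VisitsAfterStart v w → Visits G v w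
  visitsAfterStart⇒visits (step _ _ w) h = inj₂ h

  visits⇒visitsAfterStart : ∀ {a b v} (w : Walk G a b) → Visits G v w → v ≢ a → VisitsAfterStart v w
  visits⇒visitsAfterStart here         refl     v≢a = ⊥-elim (v≢a refl)
  visits⇒visitsAfterStart (step _ _ w) (inj₁ h) v≢a = ⊥-elim (v≢a h)
  visits⇒visitsAfterStart (step _ _ w) (inj₂ h) v≢a = h

  visitsAfterStart-++⁺ʳ : ∀ {a b c v} (p : Walk G a b) (q : Walk G b c) →
                          VisitsAfterStart v q → VisitsAfterStart v (p ++ q)
  visitsAfterStart-++⁺ʳ here         q h = h
  visitsAfterStart-++⁺ʳ (step _ _ p) q h = visits-++⁺ʳ p q (visitsAfterStart⇒visits q h)

  uses-++⁻ : ∀ {a b c f} (p : Walk G a b) (q : Walk G b c) →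
             Uses G f (p ++ q) → Uses G f p ⊎ Uses G f q
  uses-++⁻ here         q h        = inj₂ h
  uses-++⁻ (step _ _ p) q (inj₁ h) = inj₁ (inj₁ h)
  uses-++⁻ (step _ _ p) q (inj₂ h) = map₁ inj₂ (uses-++⁻ p q h)

  visits-via-edge : ∀ {a c v f} (p : Walk G a (src f)) (q : Walk G (tgt f) c) →
                    Visits G v (p ++ step f refl q) → Visits G v p ⊎ Visits G v q
  visits-via-edge {v = v} p q h with visits-++⁻ p (step _ refl q) h
  ... | inj₁ in-p          = inj₁ in-p
  ... | inj₂ (inj₁ v≡src) = inj₁ (subst (λ u → Visits G u p) (sym v≡src) (visits-end p))
  ... | inj₂ (inj₂ in-q)   = inj₂ in-q

  uses-subst-end : ∀ {a b b′ f} (eq : b ≡ b′) (w : Walk G a b) →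
                   Uses G f (subst (Walk G a) eq w) → Uses G f w
  uses-subst-end refl w h = h

  uses⇒visits-tgt : ∀ {a b f} (w : Walk G a b) → Uses G f w → Visits G (tgt f) w
  uses⇒visits-tgt (step _ _ w) (inj₁ refl) = inj₂ (visits-start w)
  uses⇒visits-tgt (step _ _ w) (inj₂ h)    = inj₂ (uses⇒visits-tgt w h)

  uses⇒visitsBeforeEnd-src : ∀ {a b f} (w : Walk G a b) → Uses G f w → VisitsBeforeEnd (src f) w
  uses⇒visitsBeforeEnd-src (step _ eq w) (inj₁ refl) = inj₁ eq
  uses⇒visitsBeforeEnd-src (step _ _ w)  (inj₂ h)    = inj₂ (uses⇒visitsBeforeEnd-src w h)

  uses⇒visits-src : ∀ {a b f} (w : Walk G a b) → Uses G f w → Visits G (src f) w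
  uses⇒visits-src w h = visitsBeforeEnd⇒visits w (uses⇒visitsBeforeEnd-src w h)

  visits? : ∀ {a b} u (w : Walk G a b) → Dec (Visits G u w)
  visits? {a} u here             = u ≟ a
  visits? u (step {a} _ _ w) = (u ≟ a) ⊎-dec visits? u w

  uses? : ∀ {a b} f (w : Walk G a b) → Dec (Uses G f w)
  uses? f here         = no λ ()
  uses? f (step e _ w) = (f ≟ e) ⊎-dec uses? f w

  walk⇒reachWithout : ∀ {a b e} (w : Walk G a b) → ¬ Uses G e w → ReachWithout G e a b
  walk⇒reachWithout here          _  = here
  walk⇒reachWithout (step f eq w) ¬u =
    step f (λ f≡e → ¬u (inj₁ (sym f≡e))) eq (walk⇒reachWithout w (¬u ∘ inj₂))

  ≡⇒reachWithout : ∀ {a b e} → a ≡ b → ReachWithout G e a b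
  ≡⇒reachWithout refl = here

  reachWithout-trans : ∀ {a b c e} →
                       ReachWithout G e a b → ReachWithout G e b c → ReachWithout G e a c
  reachWithout-trans here                q = q
  reachWithout-trans (step f f≢e eq p) q = step f f≢e eq (reachWithout-trans p q)

  Split : ∀ {a b} → Fin n → Walk G a b → Set
  Split {a} {b} t w = Σ (Walk G a t) λ p → Σ (Walk G t b) λ q → p ++ q ≡ w

  split-at-first : ∀ {a b t} (w : Walk G a b) → Visits G t w →
                   Σ (Split t w) λ (p , _) → ¬ VisitsBeforeEnd t p
  split-at-first here refl = (here , here , refl) , λ ()
  split-at-first {t = t} (step {a} e eq w) h with t ≟ a
  ... | yes refl = (here , step e eq w , refl) , λ ()
  ... | no t≢a with split-at-first w (visits⇒visitsAfterStart (step e eq w) h t≢a)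
  ...   | (p , q , p++q≡w) , fresh = (step e eq p , q , cong (step e eq) p++q≡w) , [ t≢a , fresh ]

  split-at-last : ∀ {a b t} (w : Walk G a b) → Visits G t w →
                  Σ (Split t w) λ (_ , q , _) → ¬ VisitsAfterStart t q
  split-at-last here refl = (here , here , refl) , λ ()
  split-at-last {t = t} (step e eq w) h with visits? t w
  ... | yes h′ with split-at-last w h′
  ...   | (p , q , p++q≡w) , fresh = (step e eq p , q , cong (step e eq) p++q≡w) , fresh
  split-at-last (step e eq w) (inj₁ refl) | no ¬h = (here , step e eq w , refl) , ¬h
  split-at-last (step e eq w) (inj₂ h)    | no ¬h = ⊥-elim (¬h h)

  split-at-edge : ∀ {a b f} (w : Walk G a b) → Uses G f w →
                  Σ (Walk G a (src f)) λ p → Σ (Walk G (tgt f) b) λ q → p ++ step f refl q ≡ w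
  split-at-edge (step e refl w) (inj₁ refl) = here , w , refl
  split-at-edge (step e eq w)   (inj₂ h) with split-at-edge w h
  ... | p , q , glue = step e eq p , q , cong (step e eq) glue

  split-at-first-satisfying : ∀ {Q : Fin n → Set} → Decidable Q → ∀ {a b} (w : Walk G a b) →
    (∀ v → Visits G v w → ¬ Q v) ⊎
    Σ (Fin n) λ t → Q t × Σ (Split t w) λ (p , _) → ∀ v → VisitsBeforeEnd v p → ¬ Q v
  split-at-first-satisfying Q? {a} here with Q? a
  ... | yes qa = inj₂ (a , qa , (here , here , refl) , λ _ ())
  ... | no ¬qa = inj₁ λ { v refl → ¬qa }
  split-at-first-satisfying Q? {a} (step e eq w) with Q? a
  ... | yes qa = inj₂ (a , qa , (here , step e eq w , refl) , λ _ ())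
  ... | no ¬qa with split-at-first-satisfying Q? w
  ...   | inj₁ none = inj₁ λ { v (inj₁ refl) → ¬qa ; v (inj₂ h) → none v h }
  ...   | inj₂ (t , qt , (p , q , p++q≡w) , before) =
            inj₂ (t , qt , (step e eq p , q , cong (step e eq) p++q≡w) ,
                  λ { v (inj₁ refl) → ¬qa ; v (inj₂ h) → before v h })

module BoundedSearch (G : Digraph) (P : Fin (Digraph.m G) → Set) (P? : Decidable P) where
  open Digraph G
  open Walks G
  open import Data.List.Membership.DecPropositional (_≟_ {n}) using (_∈?_)

  data WalkWithin (A : List (Fin n)) : Fin n → Fin n → Set where
    here : ∀ {a} → a ∈ A → WalkWithin A a a
    step : ∀ {a b} f → P f → src f ≡ a → a ∈ A → WalkWithin A (tgt f) b → WalkWithin A a b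

  start∈ : ∀ {A a b} → WalkWithin A a b → a ∈ A
  start∈ (here a∈A)         = a∈A
  start∈ (step _ _ _ a∈A _) = a∈A

  weaken : ∀ {A B a b} → A ⊆ B → WalkWithin A a b → WalkWithin B a b
  weaken A⊆B (here a∈A)           = here (A⊆B a∈A)
  weaken A⊆B (step f pf eq a∈A w) = step f pf eq (A⊆B a∈A) (weaken A⊆B w)

  ∖-⊆ : ∀ {A : List (Fin n)} {a} → A ∖ a ⊆ A
  ∖-⊆ = proj₁ ∘ ∈-∖⁻

  avoid-or-last-exit : ∀ {A a c b} → WalkWithin A c b → a ≢ b →
    WalkWithin (A ∖ a) c b ⊎ Σ (Fin m) λ f → P f × src f ≡ a × WalkWithin (A ∖ a) (tgt f) b
  avoid-or-last-exit (here c∈A) c≢b =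
    inj₁ (here (∈-∖⁺ c∈A (c≢b ∘ sym)))
  avoid-or-last-exit {a = a} (step {c} f pf eq c∈A w) a≢b with avoid-or-last-exit w a≢b
  ... | inj₂ exit = inj₂ exit
  ... | inj₁ w′ with c ≟ a
  ...   | yes refl = inj₂ (f , pf , eq , w′)
  ...   | no c≢a   = inj₁ (step f pf eq (∈-∖⁺ c∈A c≢a) w′)

  walkWithin? : ∀ k A → length A ≤ k → ∀ a b → Dec (WalkWithin A a b)
  walkWithin? k A |A|≤k a b with a ∈? A
  ... | no a∉A = no (a∉A ∘ start∈)
  ... | yes a∈A with a ≟ b
  ...   | yes refl = yes (here a∈A)
  walkWithin? zero A |A|≤0 a b | yes a∈A | no _ with <-≤-trans (∈-length a∈A) |A|≤0
  ... | ()
  walkWithin? (suc k) A |A|≤1+k a b | yes a∈A | no a≢b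
    with any? (λ f → P? f ×-dec (src f ≟ a) ×-dec walkWithin? k (A ∖ a) |A∖a|≤k (tgt f) b)
    where
      |A∖a|≤k : length (A ∖ a) ≤ k
      |A∖a|≤k = ≤-pred (<-≤-trans (∖-shrinks a∈A) |A|≤1+k)
  ... | yes (f , pf , eq , w) = yes (step f pf eq a∈A (weaken ∖-⊆ w))
  ... | no ¬exit = no λ w →
        [ (λ w′ → proj₂ (∈-∖⁻ {A = A} (start∈ w′)) refl) , ¬exit ] (avoid-or-last-exit w a≢b)

  RestrictedWalk : List (Fin n) → Fin n → Fin n → Set
  RestrictedWalk A a b =
    Σ (Walk G a b) λ w → (∀ v → Visits G v w → v ∈ A) × (∀ f → Uses G f w → P f)

  toWalk : ∀ {A a b} → WalkWithin A a b → RestrictedWalk A a b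
  toWalk (here a∈A) = here , (λ { v refl → a∈A }) , λ _ ()
  toWalk (step f pf refl a∈A w) with toWalk w
  ... | w′ , inA , inP = step f refl w′ , (λ { v (inj₁ refl) → a∈A ; v (inj₂ h) → inA v h })
                                         , λ { g (inj₁ refl) → pf ; g (inj₂ h) → inP g h }

  fromWalk : ∀ {A a b} (w : Walk G a b) →
             (∀ v → Visits G v w → v ∈ A) → (∀ f → Uses G f w → P f) → WalkWithin A a b
  fromWalk here          inA _   = here (inA _ refl)
  fromWalk (step e eq w) inA inP =
    step e (inP e (inj₁ refl)) eq (inA _ (inj₁ refl))
           (fromWalk w (λ v → inA v ∘ inj₂) (λ f → inP f ∘ inj₂))

  restrictedWalk? : ∀ A a b → Dec (RestrictedWalk A a b)
  restrictedWalk? A a b =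
    map′ toWalk (λ (w , inA , inP) → fromWalk w inA inP) (walkWithin? (length A) A ≤-refl a b)

module Avoidance (G : Digraph) where
  open Digraph G
  open Walks G

  walk-avoiding-vertex? : ∀ u a b → Dec (Σ (Walk G a b) λ w → ¬ Visits G u w)
  walk-avoiding-vertex? u a b = map′ avoids within (restrictedWalk? (allFin n ∖ u) a b)
    where
      open BoundedSearch G (λ _ → ⊤) (λ _ → yes tt)
      avoids : RestrictedWalk (allFin n ∖ u) a b → Σ (Walk G a b) λ w → ¬ Visits G u w
      avoids (w , inA , _) = w , λ h → proj₂ (∈-∖⁻ {A = allFin n} (inA u h)) refl
      within : (Σ (Walk G a b) λ w → ¬ Visits G u w) → RestrictedWalk (allFin n ∖ u) a b
      within (w , ¬h) = w , (λ v h → ∈-∖⁺ (∈-allFin v) λ { refl → ¬h h }) , _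

  walk-avoiding-edge? : ∀ e a b → Dec (Σ (Walk G a b) λ w → ¬ Uses G e w)
  walk-avoiding-edge? e a b = map′ avoids within (restrictedWalk? (allFin n) a b)
    where
      open BoundedSearch G (λ f → f ≢ e) (λ f → ¬? (f ≟ e))
      avoids : RestrictedWalk (allFin n) a b → Σ (Walk G a b) λ w → ¬ Uses G e w
      avoids (w , _ , inP) = w , λ h → inP e h refl
      within : (Σ (Walk G a b) λ w → ¬ Uses G e w) → RestrictedWalk (allFin n) a b
      within (w , ¬h) = w , (λ v _ → ∈-allFin v) , λ { f h refl → ¬h h }

1<n⇒0<2⊓n∸1 : ∀ {n} → 1 < n → 0 < 2 ⊓ n ∸ 1
1<n⇒0<2⊓n∸1 1<n = m<n⇒0<n∸m (⊓-glb ≤-refl 1<n)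

0<2⊓n∸1⇒1<n : ∀ {n} → 0 < 2 ⊓ n ∸ 1 → 1 < n
0<2⊓n∸1⇒1<n pos = m≤n⊓o⇒m≤o 2 _ (m∸n≢0⇒n<m (≢-sym (<⇒≢ pos)))

module Multiplicity (G : Digraph) (π : Fin (Digraph.n G) → Fin (Digraph.n G)) where
  open Digraph G

  MapsTo : Fin m → Fin n → Fin n → Set
  MapsTo f a c = π (src f) ≡ a × π (tgt f) ≡ c

  mapsTo-functional : ∀ {f a c a′ c′} → MapsTo f a c → MapsTo f a′ c′ → a ≡ a′ × c ≡ c′
  mapsTo-functional (refl , refl) (refl , refl) = refl , refl

  mapsTo? : ∀ a c → Decidable (λ f → MapsTo f a c)
  mapsTo? a c f = (π (src f) ≟ a) ×-dec (π (tgt f) ≟ c)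

  preimage : Fin n → Fin n → List (Fin m)
  preimage a c = filter (mapsTo? a c) (allFin m)

  ∈-preimage⁺ : ∀ {f a c} → MapsTo f a c → f ∈ preimage a c
  ∈-preimage⁺ = ∈-filter⁺ (mapsTo? _ _) (∈-allFin _)

  ∈-preimage⁻ : ∀ {f a c} → f ∈ preimage a c → MapsTo f a c
  ∈-preimage⁻ = proj₂ ∘ ∈-filter⁻ (mapsTo? _ _) {xs = allFin m}

  preimage-unique : ∀ a c → Unique (preimage a c)
  preimage-unique a c = filter⁺ (mapsTo? a c) (allFin⁺ m)

  1<length : ∀ {xs : List (Fin m)} {f g} → f ∈ xs → g ∈ xs → f ≢ g → 1 < length xs
  1<length {xs} {f} {g} f∈ g∈ f≢g =
    <-≤-trans (s≤s (∈-length (∈-filter⁺ (λ h → ¬? (h ≟ g)) f∈ f≢g)))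
              (filter-notAll (λ h → ¬? (h ≟ g)) xs (Any.map (λ g≡h h≢g → h≢g (sym g≡h)) g∈))

  element : ∀ {xs : List (Fin m)} → 0 < length xs → Σ (Fin m) (_∈ xs)
  element {f ∷ _} _ = f , here refl

  element-other-than : ∀ {xs : List (Fin m)} → Unique xs → 1 < length xs → ∀ e →
                       Σ (Fin m) λ f → f ∈ xs × f ≢ e
  element-other-than {_ ∷ []} _ (s≤s ())
  element-other-than {f ∷ g ∷ _} ((f≢g ∷ _) ∷ _) _ e with f ≟ e
  ... | yes refl = g , there (here refl) , f≢g ∘ sym
  ... | no f≢e   = f , here refl , f≢e

  multH-diag : ∀ a → multH G π a a ≡ 0
  multH-diag a with a ≟ a
  ... | yes _   = refl
  ... | no a≢a = ⊥-elim (a≢a refl)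

  multH-off-diag : ∀ {a c} → a ≢ c → multH G π a c ≡ 2 ⊓ length (preimage a c)
  multH-off-diag {a} {c} a≢c with a ≟ c
  ... | yes a≡c = ⊥-elim (a≢c a≡c)
  ... | no _    = refl

  multHWithout-diag : ∀ x y a → multHWithout G π x y a a ≡ 0
  multHWithout-diag x y a with does ((a ≟ x) ×-dec (a ≟ y))
  ... | true  = cong (_∸ 1) (multH-diag a)
  ... | false = multH-diag a

  multHWithout-at : ∀ {x y} → x ≢ y → multHWithout G π x y x y ≡ 2 ⊓ length (preimage x y) ∸ 1
  multHWithout-at {x} {y} x≢y =
    trans (cong (λ b → if b then multH G π x y ∸ 1 else multH G π x y)
                (dec-true ((x ≟ x) ×-dec (y ≟ y)) (refl , refl)))
          (cong (_∸ 1) (multH-off-diag x≢y))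

  multHWithout-elsewhere : ∀ {x y a c} → ¬ (a ≡ x × c ≡ y) → a ≢ c →
                           multHWithout G π x y a c ≡ 2 ⊓ length (preimage a c)
  multHWithout-elsewhere {x} {y} {a} {c} ¬at a≢c =
    trans (cong (λ b → if b then multH G π a c ∸ 1 else multH G π a c)
                (dec-false ((a ≟ x) ×-dec (c ≟ y)) ¬at))
          (multH-off-diag a≢c)

  multHWithout-pos⇒≢ : ∀ {x y a c} → 0 < multHWithout G π x y a c → a ≢ c
  multHWithout-pos⇒≢ {x} {y} {a} pos refl = n≮n 0 (subst (0 <_) (multHWithout-diag x y a) pos)

  module _ {e x y} (e↦xy : MapsTo e x y) where

    multHWithout-pos : ∀ {f a c} → MapsTo f a c → a ≢ c → f ≢ e → 0 < multHWithout G π x y a c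
    multHWithout-pos {f} {a} {c} f↦ac a≢c f≢e with (a ≟ x) ×-dec (c ≟ y)
    ... | yes (refl , refl) = subst (0 <_) (sym (multHWithout-at a≢c))
                              (1<n⇒0<2⊓n∸1 (1<length (∈-preimage⁺ f↦ac) (∈-preimage⁺ e↦xy) f≢e))
    ... | no ¬at            = subst (0 <_) (sym (multHWithout-elsewhere ¬at a≢c))
                              (⊓-glb (s≤s z≤n) (∈-length (∈-preimage⁺ f↦ac)))

    multHWithout-pos⁻ : ∀ {a c} → 0 < multHWithout G π x y a c →
                        Σ (Fin m) λ f → MapsTo f a c × f ≢ e
    multHWithout-pos⁻ {a} {c} pos with (a ≟ x) ×-dec (c ≟ y) | multHWithout-pos⇒≢ {x} {y} {a} {c} pos
    ... | yes (refl , refl) | a≢c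
      with element-other-than (preimage-unique a c)
             (0<2⊓n∸1⇒1<n (subst (0 <_) (multHWithout-at a≢c) pos)) e
    ...   | f , f∈ , f≢e = f , ∈-preimage⁻ f∈ , f≢e
    multHWithout-pos⁻ {a} {c} pos | no ¬at | a≢c
      with element (m≤n⊓o⇒m≤o 2 _ (subst (0 <_) (multHWithout-elsewhere ¬at a≢c) pos))
    ...   | f , f∈ = f , ∈-preimage⁻ f∈ ,
                     λ { refl → ¬at (mapsTo-functional (∈-preimage⁻ f∈) e↦xy) }

module Projection (G : Digraph) (π : Fin (Digraph.n G) → Fin (Digraph.n G)) (e : Fin (Digraph.m G))
                  {x y} (e↦xy : Multiplicity.MapsTo G π e x y) where
  open Digraph G
  open Walks G
  open Multiplicity G π

  project : ∀ {a b} → ReachWithout G e a b → ReachM G (multHWithout G π x y) (π a) (π b)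
  project here = here
  project {b = b} (step f f≢e refl p) with π (src f) ≟ π (tgt f)
  ... | yes same  = subst (λ t → ReachM G (multHWithout G π x y) t (π b)) (sym same) (project p)
  ... | no differ = step (multHWithout-pos e↦xy (refl , refl) differ f≢e) (project p)

  lift : (∀ f → π (src f) ≢ π (tgt f) → ReachWithout G e (π (src f)) (src f)) →
         (∀ f → π (src f) ≢ π (tgt f) → ReachWithout G e (tgt f) (π (tgt f))) →
         ∀ {a b} → ReachM G (multHWithout G π x y) a b → ReachWithout G e a b
  lift into-src out-of-tgt here = here
  lift into-src out-of-tgt (step {a} {c} pos rest)
    with multHWithout-pos⁻ e↦xy {a} {c} pos | multHWithout-pos⇒≢ {x} {y} {a} {c} pos
  ... | f , (refl , refl) , f≢e | differ =
        reachWithout-trans (into-src f differ)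
          (step f f≢e refl (reachWithout-trans (out-of-tgt f differ) (lift into-src out-of-tgt rest)))

module Dominators (G : Digraph) (sc : StronglyConnected G) (s : Fin (Digraph.n G)) where
  open Digraph G
  open Walks G
  open Avoidance G

  dom? : ∀ u v → Dec (Dom G s u v)
  dom? u v with walk-avoiding-vertex? u s v
  ... | yes (w , ¬h) = no λ d → ¬h (d w)
  ... | no ¬avoid    = yes (¬∃¬⇒∀ (visits? u) ¬avoid)

  avoiding-walk : ∀ {u v} → ¬ Dom G s u v → Σ (Walk G s v) λ w → ¬ Visits G u w
  avoiding-walk {u} {v} ¬d with walk-avoiding-vertex? u s v
  ... | yes avoid = avoid
  ... | no ¬avoid = ⊥-elim (¬d (¬∃¬⇒∀ (visits? u) ¬avoid))

  bridge? : ∀ e → Dec (Bridge G s e)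
  bridge? e with walk-avoiding-edge? e s (tgt e)
  ... | yes (w , ¬u) = no λ br → ¬u (br w)
  ... | no ¬avoid    = yes (¬∃¬⇒∀ (uses? e) ¬avoid)

  marked? : ∀ v → Dec (Marked G s v)
  marked? v = any? (λ e → (tgt e ≟ v) ×-dec bridge? e)

  dom-refl : ∀ v → Dom G s v v
  dom-refl v = visits-end

  s-dominates : ∀ v → Dom G s s v
  s-dominates v = visits-start

  dom-trans : ∀ {a b c} → Dom G s a b → Dom G s b c → Dom G s a c
  dom-trans {a} dab dbc w with split-at-first w (dbc w)
  ... | (p , q , p++q≡w) , _ = subst (Visits G a) p++q≡w (visits-++⁺ˡ p q (dab p))

  dom-antisym : ∀ {a b} → Dom G s a b → Dom G s b a → a ≡ b
  dom-antisym {a} {b} dab dba with split-at-first (sc s b) (visits-end _)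
  ... | (p , _) , fresh with visits⇒visitsBeforeEnd⊎end p (dab p)
  ...   | inj₂ a≡b    = a≡b
  ...   | inj₁ a-early with split-at-first p (visitsBeforeEnd⇒visits p a-early)
  ...     | (p₁ , p₂ , p₁++p₂≡p) , _ with visits⇒visitsBeforeEnd⊎end p₁ (dba p₁)
  ...       | inj₂ b≡a    = sym b≡a
  ...       | inj₁ b-early =
              ⊥-elim (fresh (subst (VisitsBeforeEnd b) p₁++p₂≡p
                                   (visitsBeforeEnd-++⁺ˡ p₁ p₂ b-early)))

  idom-not-dominated : ∀ {p v} → IDom G s p v → ¬ Dom G s v p
  idom-not-dominated (p≢v , dpv , _) dvp = p≢v (dom-antisym dpv dvp)

  bridge⇒idom : ∀ {b z} → Bridge G s b → tgt b ≡ z → IDom G s (src b) z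
  bridge⇒idom {b} br refl = src≢tgt , (λ w → uses⇒visits-src w (br w)) , dominates-src
    where
      src≢tgt : src b ≢ tgt b
      src≢tgt src≡tgt with split-at-first (sc s (tgt b)) (visits-end _)
      ... | (p , _) , fresh =
            fresh (subst (λ t → VisitsBeforeEnd t p) src≡tgt (uses⇒visitsBeforeEnd-src p (br p)))
      dominates-src : ∀ w → w ≢ tgt b → Dom G s w (tgt b) → Dom G s w (src b)
      dominates-src w w≢tgt d q with visits-via-edge q here (d (q ++ step b refl here))
      ... | inj₁ in-q  = in-q
      ... | inj₂ w≡tgt = ⊥-elim (w≢tgt w≡tgt)

  entering-edge : ∀ {z} f → ¬ Dom G s z (src f) → Dom G s z (tgt f) → tgt f ≡ z
  entering-edge f ¬dsrc dtgt with avoiding-walk ¬dsrc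
  ... | ω , ¬hω with visits-via-edge ω here (dtgt (ω ++ step f refl here))
  ...   | inj₁ h     = ⊥-elim (¬hω h)
  ...   | inj₂ z≡tgt = sym z≡tgt

  bridge-unique-entry : ∀ {b z} → Bridge G s b → tgt b ≡ z →
                        ∀ f → ¬ Dom G s z (src f) → Dom G s z (tgt f) → f ≡ b
  bridge-unique-entry {b} br refl f ¬dsrc dtgt with avoiding-walk ¬dsrc
  ... | ω , ¬hω with uses-++⁻ ω (step f refl here)
                       (uses-subst-end eq _ (br (subst (Walk G s) eq (ω ++ step f refl here))))
    where eq = entering-edge f ¬dsrc dtgt
  ...   | inj₁ u          = ⊥-elim (¬hω (uses⇒visits-tgt ω u))
  ...   | inj₂ (inj₁ b≡f) = sym b≡f

  walk-stays-outside : ∀ {b z} → Bridge G s b → tgt b ≡ z → ∀ {a c} (w : Walk G a c) →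
                       ¬ Dom G s z a → ¬ VisitsBeforeEnd (src b) w →
                       ∀ v → Visits G v w → ¬ Dom G s z v
  walk-stays-outside br eq here            ¬da _     v refl        = ¬da
  walk-stays-outside br eq (step f refl w) ¬da fresh v (inj₁ refl) = ¬da
  walk-stays-outside {z = z} br eq (step f refl w) ¬da fresh v (inj₂ h) =
    walk-stays-outside br eq w ¬dtgt (fresh ∘ inj₂) v h
    where
      ¬dtgt : ¬ Dom G s z (tgt f)
      ¬dtgt d = fresh (inj₁ (cong src (sym (bridge-unique-entry br eq f ¬da d))))

  -- If the last stretch of a walk from z to t used e, a walk to src e avoiding z
  -- followed by the rest of that stretch would reach t without meeting z.
  reach-from-dominator : ∀ {e z t} → ¬ Dom G s z (src e) → Dom G s z t → ReachWithout G e z t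
  reach-from-dominator {e} {z} {t} ¬dsrc dt with split-at-last (sc s t) (dt (sc s t))
  ... | (_ , β , _) , fresh with uses? e β
  ...   | no ¬u = walk⇒reachWithout β ¬u
  ...   | yes u with split-at-edge β u | avoiding-walk ¬dsrc
  ...     | γ , δ , γeδ≡β | ω , ¬hω with visits-via-edge ω δ (dt (ω ++ step e refl δ))
  ...       | inj₁ h = ⊥-elim (¬hω h)
  ...       | inj₂ h =
              ⊥-elim (fresh (subst (VisitsAfterStart z) γeδ≡β (visitsAfterStart-++⁺ʳ γ (step e refl δ) h)))

module Contraction (G : Digraph) (sc : StronglyConnected G) (s r : Fin (Digraph.n G))
                   (r-marked-or-s : Marked G s r ⊎ r ≡ s)
                   (π : Fin (Digraph.n G) → Fin (Digraph.n G)) (contraction : IsContraction G s r π) where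
  open Digraph G
  open Walks G
  open Dominators G sc s

  MarkedChild : Fin n → Fin n → Set
  MarkedChild p z = Marked G s z × IDom G s p z × InT G s r p

  π-in-T : ∀ {w} → InT G s r w → π w ≡ w
  π-in-T = proj₁ contraction _

  π-below : ∀ {p z w} → MarkedChild p z → Dom G s z w → π w ≡ z
  π-below {p} {z} {w} (z-marked , idom , p∈T) = proj₁ (proj₂ contraction) z p w z-marked idom p∈T

  π-outside : ∀ {p w} → r ≢ s → IDom G s p r → ¬ Dom G s r w → π w ≡ p
  π-outside r≢s idom = proj₂ (proj₂ contraction) r≢s _ _ idom

  r∈T : InT G s r r
  r∈T = dom-refl r , λ w drw dwr _ → dom-antisym dwr drw

  r-dominates-child : ∀ {p z} → MarkedChild p z → Dom G s r z
  r-dominates-child (_ , (_ , dpz , _) , (drp , _)) = dom-trans drp dpz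

  below⇒∉T : ∀ {p z t} → MarkedChild p z → Dom G s z t → ¬ InT G s r t
  below⇒∉T {p} {z} child@(z-marked , idom , (drp , _)) dzt (_ , only-r) =
    idom-not-dominated idom
      (subst (λ v → Dom G s v p) (sym (only-r z (r-dominates-child child) dzt z-marked)) drp)

  data Region (w : Fin n) : Set where
    in-T    : InT G s r w → Region w
    below   : ∀ {p} z → MarkedChild p z → Dom G s z w → Region w
    outside : r ≢ s → ∀ b → tgt b ≡ r → Bridge G s b → ¬ Dom G s r w → Region w

  MarkedBetween : Fin n → Fin n → Set
  MarkedBetween w z = Marked G s z × Dom G s r z × Dom G s z w × z ≢ r

  markedBetween? : ∀ w → Decidable (MarkedBetween w)
  markedBetween? w z = marked? z ×-dec dom? r z ×-dec dom? z w ×-dec ¬? (z ≟ r)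

  -- The first vertex z of MarkedBetween w met on a walk from s to w is the one
  -- closest to r, so the parent of z still lies in T(r).
  region-under-r : ∀ {w} → Dom G s r w → Region w
  region-under-r {w} drw with split-at-first-satisfying (markedBetween? w) (sc s w)
  ... | inj₁ none = in-T (drw , λ v drv dvw v-marked →
          decidable-stable (v ≟ r) λ v≢r → none v (dvw (sc s w)) (v-marked , drv , dvw , v≢r))
  ... | inj₂ (z , (z-marked@(b , tgt≡z , br) , drz , dzw , z≢r) , (p , _) , none-earlier) =
        below z (z-marked , idom , src∈T) dzw
    where
      idom : IDom G s (src b) z
      idom = bridge⇒idom br tgt≡z
      only-r : ∀ v → Dom G s r v → Dom G s v (src b) → Marked G s v → v ≡ r
      only-r v drv dv-src v-marked = decidable-stable (v ≟ r) λ v≢r →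
        [ (λ early → none-earlier v early (v-marked , drv , dom-trans dvz dzw , v≢r))
        , (λ v≡z → idom-not-dominated idom (subst (λ u → Dom G s u (src b)) v≡z dv-src)) ]
        (visits⇒visitsBeforeEnd⊎end p (dvz p))
        where dvz = dom-trans dv-src (proj₁ (proj₂ idom))
      src∈T : InT G s r (src b)
      src∈T = proj₂ (proj₂ idom) r (z≢r ∘ sym) drz , only-r

  r≢s-outside-D[r] : ∀ {w} → ¬ Dom G s r w → r ≢ s
  r≢s-outside-D[r] {w} ¬drw r≡s = ¬drw (subst (λ v → Dom G s v w) (sym r≡s) (s-dominates w))

  region-outside-D[r] : ∀ {w} → Marked G s r ⊎ r ≡ s → ¬ Dom G s r w → Region w
  region-outside-D[r] (inj₁ (b , tgt≡r , br)) ¬drw = outside (r≢s-outside-D[r] ¬drw) b tgt≡r br ¬drw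
  region-outside-D[r] (inj₂ r≡s)              ¬drw = ⊥-elim (r≢s-outside-D[r] ¬drw r≡s)

  region : ∀ w → Region w
  region w with dom? r w
  ... | yes drw = region-under-r drw
  ... | no ¬drw = region-outside-D[r] r-marked-or-s ¬drw

  π-idempotent : ∀ w → π (π w) ≡ π w
  π-idempotent w with region w
  ... | in-T w∈T = cong π (π-in-T w∈T)
  ... | below z child dzw rewrite π-below child dzw = π-below child (dom-refl z)
  ... | outside r≢s b tgt≡r br ¬drw rewrite π-outside r≢s (bridge⇒idom br tgt≡r) ¬drw =
        π-outside r≢s idom (idom-not-dominated idom)
    where idom = bridge⇒idom br tgt≡r

  image-fixed : ∀ {u} → VertexH G π u → π u ≡ u
  image-fixed (w , refl) = π-idempotent w

  record AdmissibleEdge (e : Fin m) : Set where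
    field
      src-fixed     : π (src e) ≡ src e
      tgt-fixed     : π (tgt e) ≡ tgt e
      touches-D[r]  : Dom G s r (src e) ⊎ Dom G s r (tgt e)
      src-not-below : ∀ {p z} → MarkedChild p z → ¬ Dom G s z (src e)

  admissible : ∀ e →
    ((InT G s r (src e) × InT G s r (tgt e)) ⊎
     (Marked G s (tgt e) × IDom G s (src e) (tgt e) × InT G s r (src e)) ⊎
     (r ≢ s × IDom G s (src e) r × tgt e ≡ r)) →
    AdmissibleEdge e
  admissible e (inj₁ (src∈T , tgt∈T)) = record
    { src-fixed     = π-in-T src∈T
    ; tgt-fixed     = π-in-T tgt∈T
    ; touches-D[r]  = inj₁ (proj₁ src∈T)
    ; src-not-below = λ child dz-src → below⇒∉T child dz-src src∈T
    }
  admissible e (inj₂ (inj₁ (tgt-marked , idom , src∈T))) = record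
    { src-fixed     = π-in-T src∈T
    ; tgt-fixed     = π-below (tgt-marked , idom , src∈T) (dom-refl (tgt e))
    ; touches-D[r]  = inj₁ (proj₁ src∈T)
    ; src-not-below = λ child dz-src → below⇒∉T child dz-src src∈T
    }
  admissible e (inj₂ (inj₂ (r≢s , idom , tgt≡r))) = record
    { src-fixed     = π-outside r≢s idom (idom-not-dominated idom)
    ; tgt-fixed     = subst (λ v → π v ≡ v) (sym tgt≡r) (π-in-T r∈T)
    ; touches-D[r]  = inj₂ (subst (Dom G s r) (sym tgt≡r) (dom-refl r))
    ; src-not-below = λ child dz-src → idom-not-dominated idom (dom-trans (r-dominates-child child) dz-src)
    }

  module Lifting (e : Fin m) (adm : AdmissibleEdge e) where
    open AdmissibleEdge adm

    reach-to-src : ∀ f → π (src f) ≢ π (tgt f) → ReachWithout G e (π (src f)) (src f)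
    reach-to-src f differ with region (src f)
    ... | in-T src∈T = ≡⇒reachWithout (π-in-T src∈T)
    ... | below z child dz-src =
          subst (λ v → ReachWithout G e v (src f)) (sym (π-below child dz-src))
                (reach-from-dominator (src-not-below child) dz-src)
    ... | outside r≢s b tgt≡r br ¬dr-src =
          ≡⇒reachWithout (trans (π-outside r≢s idom ¬dr-src) (cong src (sym f≡b)))
      where
        idom = bridge⇒idom br tgt≡r
        dr-tgt : Dom G s r (tgt f)
        dr-tgt = decidable-stable (dom? r (tgt f)) λ ¬dr-tgt →
                   differ (trans (π-outside r≢s idom ¬dr-src) (sym (π-outside r≢s idom ¬dr-tgt)))
        f≡b : f ≡ b
        f≡b = bridge-unique-entry br tgt≡r f ¬dr-src dr-tgt

    reach-from-tgt : ∀ f → π (src f) ≢ π (tgt f) → ReachWithout G e (tgt f) (π (tgt f))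
    reach-from-tgt f differ with region (tgt f)
    ... | in-T tgt∈T = ≡⇒reachWithout (sym (π-in-T tgt∈T))
    ... | below z child dz-tgt =
          ≡⇒reachWithout (trans (entering-edge f ¬dz-src dz-tgt) (sym (π-below child dz-tgt)))
      where
        ¬dz-src : ¬ Dom G s z (src f)
        ¬dz-src dz-src = differ (trans (π-below child dz-src) (sym (π-below child dz-tgt)))
    ... | outside r≢s b tgt≡r br ¬dr-tgt with split-at-first (sc (tgt f) (src b)) (visits-end _)
    ...   | (q , _) , fresh =
            subst (ReachWithout G e (tgt f)) (sym (π-outside r≢s (bridge⇒idom br tgt≡r) ¬dr-tgt))
                  (walk⇒reachWithout q avoids-e)
      where
        outside-D[r] : ∀ v → Visits G v q → ¬ Dom G s r v
        outside-D[r] = walk-stays-outside br tgt≡r q ¬dr-tgt fresh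
        avoids-e : ¬ Uses G e q
        avoids-e u =
          [ outside-D[r] _ (uses⇒visits-src q u) , outside-D[r] _ (uses⇒visits-tgt q u) ] touches-D[r]

lemma12 : (G : Digraph) → StronglyConnected G → (s r : Vertex G) →
    (Marked G s r ⊎ r ≡ s) →
    (π : Vertex G → Vertex G) → IsContraction G s r π →
    (u v : Vertex G) → VertexH G π u → VertexH G π v →
    (x y : Vertex G) → (e : Fin (Digraph.m G)) →
    Digraph.src G e ≡ x → Digraph.tgt G e ≡ y →
    ((InT G s r x × InT G s r y) ⊎
    (Marked G s y × IDom G s x y × InT G s r x) ⊎
    (¬ r ≡ s × IDom G s x r × y ≡ r)) →
    (ReachWithout G e u v → ReachM G (multHWithout G π x y) u v) ×
    (ReachM G (multHWithout G π x y) u v → ReachWithout G e u v)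
lemma12 G sc s r r-marked-or-s π contraction u v u∈H v∈H x y e refl refl cases =
  (λ reach → subst₂ (ReachM G _) (image-fixed u∈H) (image-fixed v∈H) (project reach)) ,
  lift reach-to-src reach-from-tgt
  where
    open Contraction G sc s r r-marked-or-s π contraction
    adm = admissible e cases
    open AdmissibleEdge adm
    open Lifting e adm
    open Projection G π e (src-fixed , tgt-fixed)
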